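{- Let $A\subseteq(0,1)$ be countable, let $T$ be a maximally strongly consistent $\mathcal{L}$-theory in the Gödel logic $\mathfrak{G}_{[0,1],A}$, and let $\varphi,\psi$ be $\mathcal L$-sentences. Then: (1) $T$ is deductively complete; (2) if $\varphi\vee\psi\in T$, then $\varphi\in T$ or $\psi\in T$; (3) if the set $A'$ of limit points of $A$ in $[0,1]$ equals $\{0\}$ and $\bar r\to\varphi\in T$ for every $r\in A\cup\{1\}$, then $\varphi\in T$.
   Context: The logic $\mathfrak{G}_{[0,1],A}$ over a first-order language $\mathcal{L}$ has connectives $\wedge,\to,\bot$, quantifiers $\forall,\exists$, and nullary connectives $\bar r$ for $r\in A$ ($\bar1$ is $\bot$, $\bar0$ available). Abbreviations: $\neg\varphi:=\varphi\to\bot$, $\varphi\vee\psi:=((\varphi\to\psi)\to\psi)\wedge((\psi\to\varphi)\to\varphi)$, $\varphi\leftrightarrow\psi:=(\varphi\to\psi)\wedge(\psi\to\varphi)$. Proof system: axioms (G1) $(\varphi\to\psi)\to((\psi\to\chi)\to(\varphi\to\chi))$; (G2) $(\varphi\wedge\psi)\to\varphi$; (G3) $(\varphi\wedge\psi)\to(\psi\wedge\varphi)$; (G4) $\varphi\to(\varphi\wedge\varphi)$; (G5) $(\varphi\to(\psi\to\chi))\leftrightarrow((\varphi\wedge\psi)\to\chi)$; (G6) $((\varphi\to\psi)\to\chi)\to(((\psi\to\varphi)\to\chi)\to\chi)$; (G7) $\bar1\to\varphi$; (G$\forall$1) $\forall x\varphi(x)\to\varphi(t)$; (G$\forall$2)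 $\forall x(\psi\to\varphi(x))\to(\psi\to\forall x\varphi(x))$, $x$ not free in $\psi$; (G$\forall$3) $\forall x(\psi\vee\varphi(x))\to(\psi\vee\forall x\varphi(x))$, $x$ not free in $\psi$; (G$\exists$1) $\varphi(t)\to\exists x\varphi(x)$; (G$\exists$2) $\forall x(\varphi(x)\to\psi)\to(\exists x\varphi(x)\to\psi)$, $x$ not free in $\psi$ ($t$ substitutable); for $r,s\in A\cup\{0,1\}$: (RG1) $(\bar r\wedge\bar s)\leftrightarrow\overline{\max\{r,s\}}$; (RG2a) $\bar r\to\bar s$ for $r\ge s$; (RG2b) $(\bar r\to\bar s)\leftrightarrow\bar s$ for $r<s$; (RG3) $\neg\neg\bar r$ for $r<1$; rules modus ponens and generalization. $T\vdash\varphi$ means a finite derivation from $T$ and the axioms; theories are sets of sentences. $T$ is strongly consistent if $T\nvdash\bar r$ for every $r\in A\cup\{1\}$; it is maximally strongly consistent if it is strongly consistent and no $\mathcal L$-theory properly containing it is strongly consistent. $T$ is deductively complete if for all $\mathcal L$-sentences $\varphi,\psi$, $T\vdash\varphi\to\psi$ or $T\vdash\psi\to\varphi$. -}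

module Defs where

open import Data.Nat using (ℕ; zero; suc) renaming (_<_ to _<ℕ_)
open import Data.Vec using (Vec; []; _∷_)
open import Data.Vec.Relation.Unary.All using (All)
open import Data.Product using (Σ; ∃; _×_; _,_)
open import Data.Sum using (_⊎_)
open import Relation.Binary.PropositionalEquality using (_≡_; _≢_)
open import Relation.Binary.Structures using (IsStrictTotalOrder)
open import Relation.Nullary using (¬_)

-- The real line, given axiomatically as its order structure:
-- a separable, dense, Dedekind-complete strict total order without
-- endpoints (this characterises (ℝ,<) up to isomorphism, Cantor),
-- together with two points 0ℝ < 1ℝ (the reals 0 and 1).

record RealLine : Set₁ where
  field
    Carrier   : Set
    _<_       : Carrier → Carrier → Set
    isSTO     : IsStrictTotalOrder _≡_ _<_
    dense     : ∀ {x y} → x < y → ∃ λ z → x < z × z < y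
    noMin     : ∀ x → ∃ λ y → y < x
    noMax     : ∀ x → ∃ λ y → x < y
    separable : Σ (ℕ → Carrier) λ d →
                  ∀ {x y} → x < y → ∃ λ n → x < d n × d n < y
    complete  : (P : Carrier → Set) → ∃ P →
                  (∃ λ b → ∀ x → P x → ¬ (b < x)) →
                  ∃ λ s → (∀ x → P x → ¬ (s < x)) ×
                          (∀ b → (∀ x → P x → ¬ (b < x)) → ¬ (b < s))
    0ℝ 1ℝ     : Carrier
    0<1       : 0ℝ < 1ℝ

  _≤_ : Carrier → Carrier → Set
  x ≤ y = ¬ (y < x)

record Signature : Set₁ where
  field
    Fun      : Set
    funArity : Fun → ℕ
    Rel      : Set
    relArity : Rel → ℕ

open Signature

data Term (L : Signature) : Set where
  var : ℕ → Term L
  fn  : (f : Fun L) → Vec (Term L) (funArity L f) → Term L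

-- Truth constants: 0̄, 1̄ (= ⊥) and r̄ for r ∈ A, where A is indexed by I.
data Const (I : Set) : Set where
  c0 c1 : Const I
  cA    : I → Const I

infixr 6 _∧'_
infixr 5 _⇒_

data Formula (L : Signature) (I : Set) : Set where
  rel   : (R : Rel L) → Vec (Term L) (relArity L R) → Formula L I
  _∧'_  : Formula L I → Formula L I → Formula L I
  _⇒_   : Formula L I → Formula L I → Formula L I
  cst   : Const I → Formula L I
  all   : Formula L I → Formula L I
  ex    : Formula L I → Formula L I

module _ {L : Signature} where

  mutual
    renT : (ℕ → ℕ) → Term L → Term L
    renT ρ (var k)   = var (ρ k)
    renT ρ (fn f ts) = fn f (renTs ρ ts)

    renTs : ∀ {n} → (ℕ → ℕ) → Vec (Term L) n → Vec (Term L) n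
    renTs ρ []       = []
    renTs ρ (t ∷ ts) = renT ρ t ∷ renTs ρ ts

  liftR : (ℕ → ℕ) → ℕ → ℕ
  liftR ρ zero    = zero
  liftR ρ (suc k) = suc (ρ k)

  mutual
    subT : (ℕ → Term L) → Term L → Term L
    subT σ (var k)   = σ k
    subT σ (fn f ts) = fn f (subTs σ ts)

    subTs : ∀ {n} → (ℕ → Term L) → Vec (Term L) n → Vec (Term L) n
    subTs σ []       = []
    subTs σ (t ∷ ts) = subT σ t ∷ subTs σ ts

  liftS : (ℕ → Term L) → ℕ → Term L
  liftS σ zero    = var zero
  liftS σ (suc k) = renT suc (σ k)

  mutual
    BoundT : ℕ → Term L → Set
    BoundT n (var k)   = k <ℕ n
    BoundT n (fn f ts) = BoundTs n ts

    BoundTs : ∀ {m} → ℕ → Vec (Term L) m → Set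
    BoundTs n []       = Data.Unit.⊤
      where import Data.Unit
    BoundTs n (t ∷ ts) = BoundT n t × BoundTs n ts

  module _ {I : Set} where

    renF : (ℕ → ℕ) → Formula L I → Formula L I
    renF ρ (rel R ts) = rel R (renTs ρ ts)
    renF ρ (φ ∧' ψ)   = renF ρ φ ∧' renF ρ ψ
    renF ρ (φ ⇒ ψ)    = renF ρ φ ⇒ renF ρ ψ
    renF ρ (cst c)    = cst c
    renF ρ (all φ)    = all (renF (liftR ρ) φ)
    renF ρ (ex φ)     = ex (renF (liftR ρ) φ)

    -- shift: weaken a formula under a new binder ("x not free in ψ")
    shift : Formula L I → Formula L I
    shift = renF suc

    subF : (ℕ → Term L) → Formula L I → Formula L I
    subF σ (rel R ts) = rel R (subTs σ ts)
    subF σ (φ ∧' ψ)   = subF σ φ ∧' subF σ ψ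
    subF σ (φ ⇒ ψ)    = subF σ φ ⇒ subF σ ψ
    subF σ (cst c)    = cst c
    subF σ (all φ)    = all (subF (liftS σ) φ)
    subF σ (ex φ)     = ex (subF (liftS σ) φ)

    _[_] : Formula L I → Term L → Formula L I
    φ [ t ] = subF σ φ
      where
        σ : ℕ → Term L
        σ zero    = t
        σ (suc k) = var k

    BoundF : ℕ → Formula L I → Set
    BoundF n (rel R ts) = BoundTs n ts
    BoundF n (φ ∧' ψ)   = BoundF n φ × BoundF n ψ
    BoundF n (φ ⇒ ψ)    = BoundF n φ × BoundF n ψ
    BoundF n (cst c)    = Data.Unit.⊤
      where import Data.Unit
    BoundF n (all φ)    = BoundF (suc n) φ
    BoundF n (ex φ)     = BoundF (suc n) φ

    Sentence : Formula L I → Set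
    Sentence = BoundF 0

    ⊥' : Formula L I
    ⊥' = cst c1

    ¬'_ : Formula L I → Formula L I
    ¬' φ = φ ⇒ ⊥'

    _∨'_ : Formula L I → Formula L I → Formula L I
    φ ∨' ψ = ((φ ⇒ ψ) ⇒ ψ) ∧' ((ψ ⇒ φ) ⇒ φ)

    _⇔_ : Formula L I → Formula L I → Formula L I
    φ ⇔ ψ = (φ ⇒ ψ) ∧' (ψ ⇒ φ)

-- The logic 𝔊_{[0,1],A}; A is the image of val : I → ℝ.

module Logic (RL : RealLine) (L : Signature) (I : Set)
             (val : I → RealLine.Carrier RL) where

  open RealLine RL

  F : Set
  F = Formula L I

  valC : Const I → Carrier
  valC c0     = 0ℝ
  valC c1     = 1ℝ
  valC (cA i) = val i

  data Axiom : F → Set where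
    G1  : ∀ φ ψ χ → Axiom ((φ ⇒ ψ) ⇒ ((ψ ⇒ χ) ⇒ (φ ⇒ χ)))
    G2  : ∀ φ ψ → Axiom ((φ ∧' ψ) ⇒ φ)
    G3  : ∀ φ ψ → Axiom ((φ ∧' ψ) ⇒ (ψ ∧' φ))
    G4  : ∀ φ → Axiom (φ ⇒ (φ ∧' φ))
    G5  : ∀ φ ψ χ → Axiom ((φ ⇒ (ψ ⇒ χ)) ⇔ ((φ ∧' ψ) ⇒ χ))
    G6  : ∀ φ ψ χ → Axiom (((φ ⇒ ψ) ⇒ χ) ⇒ (((ψ ⇒ φ) ⇒ χ) ⇒ χ))
    G7  : ∀ φ → Axiom (cst c1 ⇒ φ)
    G∀1 : ∀ φ t → Axiom (all φ ⇒ (φ [ t ]))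
    G∀2 : ∀ ψ φ → Axiom (all (shift ψ ⇒ φ) ⇒ (ψ ⇒ all φ))
    G∀3 : ∀ ψ φ → Axiom (all (shift ψ ∨' φ) ⇒ (ψ ∨' all φ))
    G∃1 : ∀ φ t → Axiom ((φ [ t ]) ⇒ ex φ)
    G∃2 : ∀ φ ψ → Axiom (all (φ ⇒ shift ψ) ⇒ (ex φ ⇒ ψ))
    -- (RG1): t is the one of r, s with the larger value, i.e. max{r,s}
    RG1  : ∀ r s t → (t ≡ r ⊎ t ≡ s) → valC r ≤ valC t → valC s ≤ valC t →
           Axiom ((cst r ∧' cst s) ⇔ cst t)
    RG2a : ∀ r s → valC s ≤ valC r → Axiom (cst r ⇒ cst s)
    RG2b : ∀ r s → valC r < valC s → Axiom ((cst r ⇒ cst s) ⇔ cst s)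
    RG3  : ∀ r → valC r < 1ℝ → Axiom (¬' (¬' cst r))

  Theory : Set₁
  Theory = F → Set

  IsTheory : Theory → Set
  IsTheory T = ∀ φ → T φ → Sentence φ

  infix 4 _⊢_
  data _⊢_ (T : Theory) : F → Set where
    ax  : ∀ {φ} → Axiom φ → T ⊢ φ
    hyp : ∀ {φ} → T φ → T ⊢ φ
    mp  : ∀ {φ ψ} → T ⊢ φ → T ⊢ (φ ⇒ ψ) → T ⊢ ψ
    gen : ∀ {φ} → T ⊢ φ → T ⊢ all φ

  StronglyConsistent : Theory → Set
  StronglyConsistent T = ∀ r → r ≢ c0 → ¬ (T ⊢ cst r)

  _⊂_ : Theory → Theory → Set
  T ⊂ U = (∀ φ → T φ → U φ) × (∃ λ φ → U φ × ¬ T φ)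

  MaximallyStronglyConsistent : Theory → Set₁
  MaximallyStronglyConsistent T =
    StronglyConsistent T ×
    ¬ (Σ Theory λ U → IsTheory U × T ⊂ U × StronglyConsistent U)

  DeductivelyComplete : Theory → Set
  DeductivelyComplete T = ∀ φ ψ → Sentence φ → Sentence ψ →
    (T ⊢ (φ ⇒ ψ)) ⊎ (T ⊢ (ψ ⇒ φ))

  LimitPoint : Carrier → Set
  LimitPoint x = ∀ l u → l < x → x < u →
    ∃ λ i → val i ≢ x × l < val i × val i < u

  LimitPointsZero : Set
  LimitPointsZero = ∀ x → 0ℝ ≤ x → x ≤ 1ℝ →
    (LimitPoint x → x ≡ 0ℝ) × (x ≡ 0ℝ → LimitPoint x)

-- The central fact is ABSORPTION: a sentence χ such that T ∪ {χ} is still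
-- strongly consistent already belongs to T (by maximality, using excluded
-- middle to decide membership).  Via the deduction theorem for sentences
-- this gives deductive closure of T and the principle that of two
-- sentences χ, χ' one lies in T unless T ∪ {χ} ⊢ r̄ and T ∪ {χ'} ⊢ s̄ for
-- some truth constants r̄, s̄ other than 0̄.
--   (1) If T ∪ {φ → ψ} ⊢ r̄ and T ∪ {ψ → φ} ⊢ s̄, then by prelinearity (G6)
--       T proves the smaller of r̄, s̄, contradicting strong consistency.
--   (2) Given φ ∨ ψ, whichever implication (1) supplies resolves the
--       disjunction into φ or ψ, which then lies in T by closure.
--   (3) If T ∪ {φ} ⊢ r̄, pick a ∈ A with 0 < a < r (0 is a limit point of
--       A); from ā → φ we get T ⊢ ā → r̄, hence T ⊢ r̄ by (RG2b).
module Submission where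

open import Defs
open import Level using (0ℓ)
open import Data.Nat using (ℕ; zero; suc; s≤s) renaming (_<_ to _<ℕ_)
open import Data.Vec using (Vec; []; _∷_)
open import Data.Product using (Σ; _×_; _,_; proj₁; proj₂; ∃)
open import Data.Sum using (_⊎_; inj₁; inj₂; map)
open import Data.Empty using (⊥; ⊥-elim)
open import Relation.Nullary using (¬_; yes; no)
open import Relation.Binary.PropositionalEquality using (_≡_; _≢_; refl; cong; cong₂; subst; sym)
open import Relation.Binary using (tri<; tri≈; tri>)
open import Relation.Binary.Structures using (IsStrictTotalOrder)
open import Function using (_∘_)
open import Function.Definitions using (Injective)
open import Axiom.ExcludedMiddle using (ExcludedMiddle)

module Renaming {L : Signature} {I : Set} where

  FixesBelow : ℕ → (ℕ → ℕ) → Set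
  FixesBelow n ρ = ∀ k → k <ℕ n → ρ k ≡ k

  mutual
    renT-fixed : ∀ ρ n (t : Term L) → FixesBelow n ρ → BoundT n t → renT ρ t ≡ t
    renT-fixed ρ n (var k)   fix b = cong var (fix k b)
    renT-fixed ρ n (fn f ts) fix b = cong (fn f) (renTs-fixed ρ n ts fix b)

    renTs-fixed : ∀ {m} ρ n (ts : Vec (Term L) m) → FixesBelow n ρ → BoundTs n ts →
                  renTs ρ ts ≡ ts
    renTs-fixed ρ n []       fix b         = refl
    renTs-fixed ρ n (t ∷ ts) fix (bt , bs) =
      cong₂ _∷_ (renT-fixed ρ n t fix bt) (renTs-fixed ρ n ts fix bs)

  liftR-fixes : ∀ ρ n → FixesBelow n ρ → FixesBelow (suc n) (liftR {L = L} ρ)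
  liftR-fixes ρ n fix zero    _       = refl
  liftR-fixes ρ n fix (suc k) (s≤s p) = cong suc (fix k p)

  renF-fixed : ∀ ρ n (φ : Formula L I) → FixesBelow n ρ → BoundF n φ → renF ρ φ ≡ φ
  renF-fixed ρ n (rel R ts) fix b         = cong (rel R) (renTs-fixed ρ n ts fix b)
  renF-fixed ρ n (φ ∧' ψ)   fix (bφ , bψ) = cong₂ _∧'_ (renF-fixed ρ n φ fix bφ) (renF-fixed ρ n ψ fix bψ)
  renF-fixed ρ n (φ ⇒ ψ)    fix (bφ , bψ) = cong₂ _⇒_ (renF-fixed ρ n φ fix bφ) (renF-fixed ρ n ψ fix bψ)
  renF-fixed ρ n (cst c)    fix b         = refl
  renF-fixed ρ n (all φ)    fix b         = cong all (renF-fixed (liftR {L = L} ρ) (suc n) φ (liftR-fixes ρ n fix) b)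
  renF-fixed ρ n (ex φ)     fix b         = cong ex (renF-fixed (liftR {L = L} ρ) (suc n) φ (liftR-fixes ρ n fix) b)

  shift-sentence : (φ : Formula L I) → Sentence φ → shift φ ≡ φ
  shift-sentence φ s = renF-fixed suc 0 φ (λ k ()) s

module Derivations (RL : RealLine) (L : Signature) (I : Set)
                   (val : I → RealLine.Carrier RL) where
  open Logic RL L I val
  open RealLine RL using (_<_)
  open Renaming {L} {I}

  module _ {T : Theory} where

    ⇒-trans : ∀ {a b c} → T ⊢ (a ⇒ b) → T ⊢ (b ⇒ c) → T ⊢ (a ⇒ c)
    ⇒-trans {a} {b} {c} p q = mp q (mp p (ax (G1 a b c)))

    ∧-fst : ∀ {a b} → T ⊢ (a ∧' b) → T ⊢ a
    ∧-fst p = mp p (ax (G2 _ _))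

    ∧-snd : ∀ {a b} → T ⊢ (a ∧' b) → T ⊢ b
    ∧-snd p = ∧-fst (mp p (ax (G3 _ _)))

    ⇒-refl : ∀ a → T ⊢ (a ⇒ a)
    ⇒-refl a = ⇒-trans (ax (G4 a)) (ax (G2 a a))

    curry : ∀ {a b c} → T ⊢ ((a ∧' b) ⇒ c) → T ⊢ (a ⇒ (b ⇒ c))
    curry {a} {b} {c} p = mp p (∧-snd (ax (G5 a b c)))

    uncurry : ∀ {a b c} → T ⊢ (a ⇒ (b ⇒ c)) → T ⊢ ((a ∧' b) ⇒ c)
    uncurry {a} {b} {c} p = mp p (∧-fst (ax (G5 a b c)))

    weaken : ∀ {θ} χ → T ⊢ θ → T ⊢ (χ ⇒ θ)
    weaken {θ} χ p = mp p (curry (ax (G2 θ χ)))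

    exchange : ∀ {a b c} → T ⊢ (a ⇒ (b ⇒ c)) → T ⊢ (b ⇒ (a ⇒ c))
    exchange {a} {b} p = curry (⇒-trans (ax (G3 b a)) (uncurry p))

    contract : ∀ {a c} → T ⊢ (a ⇒ (a ⇒ c)) → T ⊢ (a ⇒ c)
    contract {a} p = ⇒-trans (ax (G4 a)) (uncurry p)

    mp-under : ∀ {χ θ θ'} → T ⊢ (χ ⇒ θ) → T ⊢ (χ ⇒ (θ ⇒ θ')) → T ⊢ (χ ⇒ θ')
    mp-under p q = contract (⇒-trans p (exchange q))

    by-cases : ∀ {φ ψ χ} → T ⊢ ((φ ⇒ ψ) ⇒ χ) → T ⊢ ((ψ ⇒ φ) ⇒ χ) → T ⊢ χ
    by-cases {φ} {ψ} {χ} p q = mp q (mp p (ax (G6 φ ψ χ)))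

    ∨-resolveʳ : ∀ {φ ψ} → T ⊢ (φ ∨' ψ) → T ⊢ (φ ⇒ ψ) → T ⊢ ψ
    ∨-resolveʳ d p = mp p (∧-fst d)

    ∨-resolveˡ : ∀ {φ ψ} → T ⊢ (φ ∨' ψ) → T ⊢ (ψ ⇒ φ) → T ⊢ φ
    ∨-resolveˡ d p = mp p (∧-snd d)

    lower-constant : ∀ {φ} i r → val i < valC r →
                     T ⊢ (cst (cA i) ⇒ φ) → T ⊢ (φ ⇒ cst r) → T ⊢ cst r
    lower-constant i r a<r p q = mp (⇒-trans p q) (∧-fst (ax (RG2b (cA i) r a<r)))

  _∪_ : Theory → F → Theory
  (T ∪ χ) φ = T φ ⊎ φ ≡ χ

  -- Deduction theorem for a sentence χ; generalisation is handled by
  -- (G∀2), applicable since χ has no free variable.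
  deduction : ∀ {T χ θ} → Sentence χ → (T ∪ χ) ⊢ θ → T ⊢ (χ ⇒ θ)
  deduction {χ = χ} s (ax a)            = weaken χ (ax a)
  deduction {χ = χ} s (hyp (inj₁ t))    = weaken χ (hyp t)
  deduction {χ = χ} s (hyp (inj₂ refl)) = ⇒-refl χ
  deduction         s (mp p q)          = mp-under (deduction s p) (deduction s q)
  deduction {T} {χ} {all θ} s (gen p)   =
    mp (subst (λ χ' → T ⊢ all (χ' ⇒ θ)) (sym (shift-sentence χ s)) (gen (deduction s p)))
       (ax (G∀2 χ θ))

module Constants (RL : RealLine) (L : Signature) (I : Set)
                 (val : I → RealLine.Carrier RL) where
  open Logic RL L I val
  open RealLine RL
  open IsStrictTotalOrder isSTO using (irrefl; asym; compare)

  positive : (∀ i → 0ℝ < val i) → ∀ r → r ≢ c0 → 0ℝ < valC r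
  positive A>0 c0     r≢0 = ⊥-elim (r≢0 refl)
  positive A>0 c1     _   = 0<1
  positive A>0 (cA i) _   = A>0 i

  smaller : ∀ r s → r ≢ c0 → s ≢ c0 →
            Σ (Const I) λ t → t ≢ c0 × valC t ≤ valC r × valC t ≤ valC s
  smaller r s r≢0 s≢0 with compare (valC r) (valC s)
  ... | tri< r<s _ _ = r , r≢0 , irrefl refl , asym r<s
  ... | tri≈ _ r≡s _ = r , r≢0 , irrefl refl , subst (λ v → ¬ (v < valC r)) r≡s (irrefl refl)
  ... | tri> _ _ s<r = s , s≢0 , asym s<r , irrefl refl

  below : LimitPointsZero → ∀ x → 0ℝ < x → ∃ λ i → val i < x
  below lpz x 0<x with noMin 0ℝ
  ... | l , l<0 with proj₂ (lpz 0ℝ (irrefl refl) (asym 0<1)) refl l x l<0 0<x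
  ... | i , _ , _ , a<x = i , a<x

module Maximal (lem : ExcludedMiddle 0ℓ)
               (RL : RealLine) (L : Signature) (I : Set) (val : I → RealLine.Carrier RL)
               (T : Logic.Theory RL L I val) (isT : Logic.IsTheory RL L I val T)
               (msc : Logic.MaximallyStronglyConsistent RL L I val T) where
  open Logic RL L I val
  open Derivations RL L I val
  open Constants RL L I val

  consistent : StronglyConsistent T
  consistent = proj₁ msc

  absorb : ∀ χ → Sentence χ → StronglyConsistent (T ∪ χ) → T χ
  absorb χ s sc∪ with lem {T χ}
  ... | yes χ∈T = χ∈T
  ... | no  χ∉T = ⊥-elim (proj₂ msc (T ∪ χ , isTheory∪ , ((λ _ → inj₁) , (χ , inj₂ refl , χ∉T)) , sc∪))
    where
      isTheory∪ : IsTheory (T ∪ χ)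
      isTheory∪ φ (inj₁ φ∈T)  = isT φ φ∈T
      isTheory∪ φ (inj₂ refl) = s

  closed : ∀ χ → Sentence χ → T ⊢ χ → T χ
  closed χ s p = absorb χ s (λ r r≢0 q → consistent r r≢0 (mp p (deduction s q)))

  one-absorbed : ∀ χ χ' → Sentence χ → Sentence χ' →
                 (∀ r s → r ≢ c0 → s ≢ c0 → (T ∪ χ) ⊢ cst r → (T ∪ χ') ⊢ cst s → ⊥) →
                 T χ ⊎ T χ'
  one-absorbed χ χ' sχ sχ' refuted with lem {T χ} | lem {T χ'}
  ... | yes χ∈T | _        = inj₁ χ∈T
  ... | no  _   | yes χ'∈T = inj₂ χ'∈T
  ... | no  χ∉T | no  χ'∉T =
    ⊥-elim (χ'∉T (absorb χ' sχ' λ s s≢0 q →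
                   χ∉T (absorb χ sχ λ r r≢0 p → refuted r s r≢0 s≢0 p q)))

  complete : DeductivelyComplete T
  complete φ ψ sφ sψ =
    map hyp hyp (one-absorbed (φ ⇒ ψ) (ψ ⇒ φ) (sφ , sψ) (sψ , sφ) refuted)
    where
      refuted : ∀ r s → r ≢ c0 → s ≢ c0 →
                (T ∪ (φ ⇒ ψ)) ⊢ cst r → (T ∪ (ψ ⇒ φ)) ⊢ cst s → ⊥
      refuted r s r≢0 s≢0 p q with smaller r s r≢0 s≢0
      ... | t , t≢0 , t≤r , t≤s = consistent t t≢0
        (by-cases (⇒-trans (deduction (sφ , sψ) p) (ax (RG2a r t t≤r)))
                  (⇒-trans (deduction (sψ , sφ) q) (ax (RG2a s t t≤s))))

  prime : ∀ φ ψ → Sentence φ → Sentence ψ → T (φ ∨' ψ) → T φ ⊎ T ψ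
  prime φ ψ sφ sψ φ∨ψ∈T with complete φ ψ sφ sψ
  ... | inj₁ φ⇒ψ = inj₂ (closed ψ sψ (∨-resolveʳ (hyp φ∨ψ∈T) φ⇒ψ))
  ... | inj₂ ψ⇒φ = inj₁ (closed φ sφ (∨-resolveˡ (hyp φ∨ψ∈T) ψ⇒φ))

  implied-by-constants : (∀ i → RealLine._<_ RL (RealLine.0ℝ RL) (val i)) →
                         LimitPointsZero → ∀ φ → Sentence φ →
                         (∀ r → r ≢ c0 → T (cst r ⇒ φ)) → T φ
  implied-by-constants A>0 lpz φ sφ r⇒φ∈T = absorb φ sφ refuted
    where
      refuted : StronglyConsistent (T ∪ φ)
      refuted r r≢0 p with below lpz (valC r) (positive A>0 r r≢0)
      ... | i , a<r = consistent r r≢0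
        (lower-constant i r a<r (hyp (r⇒φ∈T (cA i) λ ())) (deduction sφ p))

-- Lemma 3.12.
lemma3p12 : ExcludedMiddle 0ℓ →
    (RL : RealLine) (L : Signature) (I : Set) (val : I → RealLine.Carrier RL) →
    Injective _≡_ _≡_ val →
    (∀ i → RealLine._<_ RL (RealLine.0ℝ RL) (val i) × RealLine._<_ RL (val i) (RealLine.1ℝ RL)) →
    Σ (I → ℕ) (Injective _≡_ _≡_) →
    let open Logic RL L I val in
    (T : Theory) → IsTheory T → MaximallyStronglyConsistent T →
    (φ ψ : Formula L I) → Sentence φ → Sentence ψ →
    DeductivelyComplete T
    × (T (φ ∨' ψ) → T φ ⊎ T ψ)
    × (LimitPointsZero → (∀ r → r ≢ c0 → T (cst r ⇒ φ)) → T φ)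
lemma3p12 lem RL L I val _ A⊆01 _ T isT msc φ ψ sφ sψ =
  complete , prime φ ψ sφ sψ , λ lpz → implied-by-constants (proj₁ ∘ A⊆01) lpz φ sφ
  where
    open Maximal lem RL L I val T isT msc
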